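{- In the Slow Flashcard Game, there is a real constant $C$ such that for all integers $k\ge 1$ and all positive integers $\ell\le \sqrt{2k}+C$ we have $T_k(\ell)<T_1(k+1)$.
   Context: The Slow Flashcard Game is the following deterministic process with insertion sequence $p_k=k+1$. The state at each time $t=1,2,\dots$ consists of an ordering (the deck) of all positive integers (cards), positions numbered $1,2,\dots$ from the front, together with a counter for each card recording how many times it has been seen. At time $t=1$ the deck is $1,2,3,\dots$, card $1$ (at the front) has been seen once, and all other cards $0$ times. To pass from time $t$ to $t+1$: if the front card has been seen $k$ times so far, remove it and reinsert it so that it occupies position $k+1$; then the card now at the front has its counter increased by one (it is seen at time $t+1$). For $n,k\ge1$, $T_n(k)$ denotes the time at which card $n$ is seen for the $k$-th time. -}

module Defs where

open import Data.Nat using (ℕ; zero; suc; _+_; _∸_; _≤_; _<ᵇ_; _≡ᵇ_)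
open import Data.Bool using (if_then_else_)
open import Data.Product using (_×_; _,_; proj₁; proj₂)
open import Relation.Binary.PropositionalEquality using (_≡_)

-- A deck: 0-indexed position ↦ card (position i here is position i+1 in the paper).
Deck : Set
Deck = ℕ → ℕ

Counts : Set
Counts = ℕ → ℕ

State : Set
State = Deck × Counts

initDeck : Deck
initDeck i = suc i

initCounts : Counts
initCounts n = if n ≡ᵇ 1 then 1 else 0

initState : State
initState = initDeck , initCounts

-- Remove the front card x (seen k times) and reinsert it at (1-indexed) position k+1,
-- i.e. 0-indexed position k.
reinsert : Deck → ℕ → Deck
reinsert d k i =
  if i <ᵇ k then d (suc i) else (if i ≡ᵇ k then d 0 else d i)

bump : Counts → ℕ → Counts
bump c n m = if m ≡ᵇ n then suc (c m) else c m

-- Slow Flashcard Game step (insertion sequence p_k = k+1).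
step : State → State
step (d , c) =
  let d' = reinsert d (c (d 0)) in
  d' , bump c (d' 0)

-- st s = state at time s+1.
st : ℕ → State
st zero = initState
st (suc s) = step (st s)

stateAt : ℕ → State
stateAt t = st (t ∸ 1)

front : ℕ → ℕ
front t = proj₁ (stateAt t) 0

-- counter of card n at time t (including the view at time t, if any)
count : ℕ → ℕ → ℕ
count t n = proj₂ (stateAt t) n

-- Card n is seen for the k-th time at time t, i.e. T_n(k) = t.
SeenAt : ℕ → ℕ → ℕ → Set
SeenAt n k t = (1 ≤ t) × (front t ≡ n) × (count t n ≡ k)

-- In every reachable state card 1 is the most seen card, the deck beyond position
-- c(1) is still in its initial order, and cards seen equally often keep their
-- relative order. Consequently card 1 is viewed with every count K, after its K-th
-- view it sits at position K and is not viewed again during the next K steps, and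
-- every card ahead of it reaches the front first; in particular card k is at the
-- front before card 1's k-th view. From then on each step either brings card k
-- closer to its next view, or is a stall: card k + 1, seen fewer times than card k,
-- is reinserted ahead of it, which can happen at most ℓ times. So card k is seen
-- ℓ times within (1 + ⋯ + ℓ) + ℓ + 1 steps, which is at most k when (ℓ + 2)² ≤ 2k,
-- hence before the (k + 1)-st view of card 1.
module Submission where

open import Defs
open import Data.Bool using (true; false; if_then_else_)
open import Data.Empty using (⊥-elim)
open import Data.Nat
open import Data.Nat.Properties
open import Data.Nat.Tactic.RingSolver using (solve-∀)
open import Data.Product using (Σ; _×_; _,_; proj₁; proj₂; map₁; map₂)
open import Data.Sum using (_⊎_; inj₁; inj₂)
open import Function using (id; _∘_)
open import Relation.Binary using (tri<; tri≈; tri>)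
open import Relation.Binary.PropositionalEquality
open import Relation.Nullary using (yes; no)
open import Relation.Nullary.Decidable using (dec-true; dec-false)
import Data.Integer as ℤ
import Data.Integer.Properties as ℤ

reinsert-< : ∀ d {k i} → i < k → reinsert d k i ≡ d (suc i)
reinsert-< d {k} {i} i<k rewrite dec-true (i <? k) i<k = refl

reinsert-≡ : ∀ d k → reinsert d k k ≡ d 0
reinsert-≡ d k rewrite dec-false (k <? k) (n≮n k) | dec-true (k ≟ k) refl = refl

reinsert-> : ∀ d {k i} → k < i → reinsert d k i ≡ d i
reinsert-> d {k} {i} k<i rewrite dec-false (i <? k) (<⇒≯ k<i) | dec-false (i ≟ k) (>⇒≢ k<i) = refl

bump-≡ : ∀ c n → bump c n n ≡ suc (c n)
bump-≡ c n rewrite dec-true (n ≟ n) refl = refl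

bump-≢ : ∀ c {n m} → m ≢ n → bump c n m ≡ c m
bump-≢ c {n} {m} m≢n rewrite dec-false (m ≟ n) m≢n = refl

c≤bump : ∀ c n m → c m ≤ bump c n m
c≤bump c n m with m ≡ᵇ n
... | true = n≤1+n (c m)
... | false = ≤-refl

origin : ℕ → ℕ → ℕ
origin = reinsert id

reinsert-origin : ∀ d k i → reinsert d k i ≡ d (origin k i)
reinsert-origin d k i with i <ᵇ k | i ≡ᵇ k
... | true  | _     = refl
... | false | true  = refl
... | false | false = refl

data OriginView (k a : ℕ) : Set where
  shifted    : a < k → origin k a ≡ suc a → OriginView k a
  reinserted : a ≡ k → origin k a ≡ 0     → OriginView k a
  unmoved    : k < a → origin k a ≡ a     → OriginView k a

originView : ∀ k a → OriginView k a
originView k a with <-cmp a k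
... | tri< a<k _ _  = shifted a<k (reinsert-< id a<k)
... | tri≈ _ refl _ = reinserted refl (reinsert-≡ id k)
... | tri> _ _ k<a  = unmoved k<a (reinsert-> id k<a)

-- The position to which reinsert _ k moves the card at position a.
destination : ℕ → ℕ → ℕ
destination k zero    = k
destination k (suc a) = if a <ᵇ k then a else suc a

destination-< : ∀ {k a} → a < k → destination k (suc a) ≡ a
destination-< {k} {a} a<k rewrite dec-true (a <? k) a<k = refl

destination-≥ : ∀ {k a} → k ≤ a → destination k (suc a) ≡ suc a
destination-≥ {k} {a} k≤a rewrite dec-false (a <? k) (≤⇒≯ k≤a) = refl

destination-origin : ∀ k a → destination k (origin k a) ≡ a
destination-origin k a with originView k a
destination-origin k a       | shifted a<k eq    rewrite eq = destination-< a<k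
destination-origin k a       | reinserted a≡k eq rewrite eq = sym a≡k
destination-origin k zero    | unmoved () _
destination-origin k (suc a) | unmoved k<a eq    rewrite eq = destination-≥ (≤-pred k<a)

origin-destination : ∀ k a → origin k (destination k a) ≡ a
origin-destination k zero = reinsert-≡ id k
origin-destination k (suc a) with <-cmp a k
... | tri< a<k _ _ rewrite destination-< a<k = reinsert-< id a<k
... | tri≈ _ refl _ rewrite destination-≥ (≤-refl {a}) = reinsert-> id (n<1+n a)
... | tri> _ _ k<a rewrite destination-≥ (<⇒≤ k<a) = reinsert-> id (m<n⇒m<1+n k<a)

origin-injective : ∀ k a b → origin k a ≡ origin k b → a ≡ b
origin-injective k a b eq =
  trans (sym (destination-origin k a)) (trans (cong (destination k) eq) (destination-origin k b))

reinsert-destination : ∀ d k a → reinsert d k (destination k a) ≡ d a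
reinsert-destination d k a = trans (reinsert-origin d k _) (cong d (origin-destination k a))

pred≤destination : ∀ k a → a ≤ destination k (suc a)
pred≤destination k a with a <? k
... | yes a<k = ≤-reflexive (sym (destination-< a<k))
... | no a≮k  = subst (a ≤_) (sym (destination-≥ (≮⇒≥ a≮k))) (n≤1+n a)

destination-monotone : ∀ k {a b} → a < b → destination k (suc a) < destination k (suc b)
destination-monotone k {a} {b} a<b with a <? k | b <? k
... | yes a<k | yes b<k rewrite destination-< a<k | destination-< b<k = a<b
... | yes a<k | no b≮k  rewrite destination-< a<k | destination-≥ (≮⇒≥ b≮k) = m<n⇒m<1+n a<b
... | no a≮k  | yes b<k = ⊥-elim (a≮k (<-trans a<b b<k))
... | no a≮k  | no b≮k  rewrite destination-≥ (≮⇒≥ a≮k) | destination-≥ (≮⇒≥ b≮k) = s≤s a<b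

record Invariant (d : Deck) (c : Counts) : Set where
  field
    positive      : ∀ a → 1 ≤ d a
    injective     : ∀ a b → d a ≡ d b → a ≡ b
    surjective    : ∀ x → 1 ≤ x → Σ ℕ λ a → d a ≡ x
    front-seen    : 1 ≤ c (d 0)
    antitone      : ∀ x y → 1 ≤ x → x ≤ y → c y ≤ c x
    -- Cards seen equally often are in increasing order in the deck as it
    -- will be once the front card has been reinserted.
    ties-ordered  : ∀ a b → d a < d b → c (d a) ≡ c (d b) →
                    destination (c (d 0)) a < destination (c (d 0)) b
    position≤seen : ∀ a → 1 ≤ a → 1 ≤ c (d a) → a ≤ c (d a)
    untouched     : ∀ j → c 1 < j → d j ≡ suc j

initial-invariant : Invariant initDeck initCounts
initial-invariant = record
  { positive      = λ _ → s≤s z≤n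
  ; injective     = λ _ _ → suc-injective
  ; surjective    = λ { (suc x) _ → x , refl }
  ; front-seen    = s≤s z≤n
  ; antitone      = antitone
  ; ties-ordered  = ties-ordered
  ; position≤seen = λ { (suc a) _ () }
  ; untouched     = λ _ _ → refl
  }
  where
  antitone : ∀ x y → 1 ≤ x → x ≤ y → initCounts y ≤ initCounts x
  antitone (suc zero)    (suc zero)    _ _       = ≤-refl
  antitone (suc (suc x)) (suc zero)    _ (s≤s ())
  antitone _             (suc (suc y)) _ _       = z≤n
  ties-ordered : ∀ a b → initDeck a < initDeck b → initCounts (initDeck a) ≡ initCounts (initDeck b) →
                 destination 1 a < destination 1 b
  ties-ordered zero    zero    (s≤s ()) _
  ties-ordered zero    (suc b) _        ()
  ties-ordered (suc a) zero    (s≤s ()) _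
  ties-ordered (suc a) (suc b) a<b      _ = destination-monotone 1 (≤-pred (≤-pred a<b))

module Preservation {d : Deck} {c : Counts} (inv : Invariant d c) where
  open Invariant inv

  c₀ : ℕ
  c₀ = c (d 0)

  d′ : Deck
  d′ = reinsert d c₀

  c′ : Counts
  c′ = bump c (d′ 0)

  d′-origin : ∀ a → d′ a ≡ d (origin c₀ a)
  d′-origin = reinsert-origin d c₀

  positive′ : ∀ a → 1 ≤ d′ a
  positive′ a = subst (1 ≤_) (sym (d′-origin a)) (positive (origin c₀ a))

  injective′ : ∀ a b → d′ a ≡ d′ b → a ≡ b
  injective′ a b eq =
    origin-injective c₀ a b (injective _ _ (trans (sym (d′-origin a)) (trans eq (d′-origin b))))

  surjective′ : ∀ x → 1 ≤ x → Σ ℕ λ a → d′ a ≡ x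
  surjective′ x 1≤x with surjective x 1≤x
  ... | a , refl = destination c₀ a , reinsert-destination d c₀ a

  c′-front : c′ (d′ 0) ≡ suc (c (d′ 0))
  c′-front = bump-≡ c (d′ 0)

  c′-behind : ∀ a → 1 ≤ a → c′ (d′ a) ≡ c (d (origin c₀ a))
  c′-behind a 1≤a =
    trans (bump-≢ c λ eq → 1+n≰n (subst (1 ≤_) (injective′ a 0 eq) 1≤a)) (cong c (d′-origin a))

  front-seen′ : 1 ≤ c′ (d′ 0)
  front-seen′ = subst (1 ≤_) (sym c′-front) (s≤s z≤n)

  next-front-less-seen : ∀ x → 1 ≤ x → x < d 1 → c (d 1) < c x
  next-front-less-seen x 1≤x x<y with surjective x 1≤x
  ... | p , refl = ≤∧≢⇒< (antitone (d p) (d 1) 1≤x (<⇒≤ x<y)) λ tie →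
    n≮0 (subst (destination c₀ p <_) (destination-< front-seen) (ties-ordered p 1 x<y (sym tie)))

  antitone′ : ∀ x y → 1 ≤ x → x ≤ y → c′ y ≤ c′ x
  antitone′ x y 1≤x x≤y with y ≟ d′ 0
  ... | no y≢front =
    ≤-trans (≤-reflexive (bump-≢ c y≢front)) (≤-trans (antitone x y 1≤x x≤y) (c≤bump c _ x))
  ... | yes refl with x ≟ d′ 0
  ...   | yes refl = ≤-refl
  ...   | no x≢front = subst₂ _≤_ (sym c′-front) (sym (bump-≢ c x≢front))
    (subst (λ y → c y < c x) (sym (reinsert-< d front-seen))
      (next-front-less-seen x 1≤x (subst (x <_) (reinsert-< d front-seen) (≤∧≢⇒< x≤y x≢front))))

  position≤seen′ : ∀ a → 1 ≤ a → 1 ≤ c′ (d′ a) → a ≤ c′ (d′ a)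
  position≤seen′ a 1≤a 1≤seen = subst (a ≤_) (sym (c′-behind a 1≤a))
    (from-origin (originView c₀ a) (subst (1 ≤_) (c′-behind a 1≤a) 1≤seen))
    where
    from-origin : OriginView c₀ a → 1 ≤ c (d (origin c₀ a)) → a ≤ c (d (origin c₀ a))
    from-origin (shifted _ eq) h rewrite eq = ≤-trans (n≤1+n a) (position≤seen (suc a) (s≤s z≤n) h)
    from-origin (reinserted a≡c₀ eq) _ rewrite eq = ≤-reflexive a≡c₀
    from-origin (unmoved _ eq) h rewrite eq = position≤seen a 1≤a h

  ties-ordered′ : ∀ a b → d′ a < d′ b → c′ (d′ a) ≡ c′ (d′ b) →
                  destination (c′ (d′ 0)) a < destination (c′ (d′ 0)) b
  ties-ordered′ zero zero y<y _ = ⊥-elim (<-irrefl refl y<y)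
  ties-ordered′ zero (suc b) y<z tie = ⊥-elim (1+n≰n (subst (_≤ c (d′ 0)) z-count
    (antitone (d′ 0) (d′ (suc b)) (positive′ 0) (<⇒≤ y<z))))
    where
    z-count : c (d′ (suc b)) ≡ suc (c (d′ 0))
    z-count = trans (sym (trans (c′-behind (suc b) (s≤s z≤n)) (cong c (sym (d′-origin (suc b))))))
                    (trans (sym tie) c′-front)
  ties-ordered′ (suc a) zero _ tie = subst (_< c′ (d′ 0)) (sym (destination-< a<c₀′)) a<c₀′
    where
    a<c₀′ : a < c′ (d′ 0)
    a<c₀′ = subst (suc a ≤_) tie (position≤seen′ (suc a) (s≤s z≤n) (subst (1 ≤_) (sym tie) front-seen′))
  ties-ordered′ (suc a) (suc b) x<z tie = destination-monotone (c′ (d′ 0)) (≤-pred a+1<b+1)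
    where
    a+1<b+1 : suc a < suc b
    a+1<b+1 = subst₂ _<_ (destination-origin c₀ (suc a)) (destination-origin c₀ (suc b))
      (ties-ordered _ _ (subst₂ _<_ (d′-origin (suc a)) (d′-origin (suc b)) x<z)
        (trans (sym (c′-behind (suc a) (s≤s z≤n))) (trans tie (c′-behind (suc b) (s≤s z≤n)))))

  untouched′ : ∀ j → c′ 1 < j → d′ j ≡ suc j
  untouched′ j c′1<j = trans (reinsert-> d c₀<j) (untouched j c1<j)
    where
    c1<j : c 1 < j
    c1<j = ≤-<-trans (c≤bump c (d′ 0) 1) c′1<j
    c₀<j : c₀ < j
    c₀<j = ≤-<-trans (antitone 1 (d 0) ≤-refl (positive 0)) c1<j

  invariant′ : Invariant d′ c′
  invariant′ = record
    { positive      = positive′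
    ; injective     = injective′
    ; surjective    = surjective′
    ; front-seen    = front-seen′
    ; antitone      = antitone′
    ; ties-ordered  = ties-ordered′
    ; position≤seen = position≤seen′
    ; untouched     = untouched′
    }

-- Indexed like st: step s is the time s + 1 of the game.
deck : ℕ → Deck
deck s = proj₁ (st s)

seen : ℕ → Counts
seen s = proj₂ (st s)

invariant : ∀ s → Invariant (deck s) (seen s)
invariant zero    = initial-invariant
invariant (suc s) = Preservation.invariant′ (invariant s)

card-positive : ∀ s i → 1 ≤ deck s i
card-positive s = Invariant.positive (invariant s)

seen≤seen-card1 : ∀ s {x} → 1 ≤ x → seen s x ≤ seen s 1
seen≤seen-card1 s 1≤x = Invariant.antitone (invariant s) 1 _ ≤-refl 1≤x

frontCount : ℕ → ℕ
frontCount s = seen s (deck s 0)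

Viewed : ℕ → ℕ → ℕ → Set
Viewed x m s = deck s 0 ≡ x × seen s x ≡ m

front-unique : ∀ s {i} → 1 ≤ i → deck s i ≢ deck s 0
front-unique s {suc i} _ eq with Invariant.injective (invariant s) (suc i) 0 eq
... | ()

deck-suc-destination : ∀ s a → deck (suc s) (destination (frontCount s) a) ≡ deck s a
deck-suc-destination s = reinsert-destination (deck s) (frontCount s)

card-reinserted : ∀ s {x} → deck s 0 ≡ x → deck (suc s) (frontCount s) ≡ x
card-reinserted s at = trans (reinsert-≡ (deck s) (frontCount s)) at

card-advances : ∀ s {a x} → deck s (suc a) ≡ x → a < frontCount s → deck (suc s) a ≡ x
card-advances s at a<c₀ = trans (reinsert-< (deck s) a<c₀) at

card-stays : ∀ s {a x} → deck s (suc a) ≡ x → frontCount s ≤ a → deck (suc s) (suc a) ≡ x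
card-stays s at c₀≤a = trans (reinsert-> (deck s) (s≤s c₀≤a)) at

seen-suc-front : ∀ s {x} → deck (suc s) 0 ≡ x → seen (suc s) x ≡ suc (seen s x)
seen-suc-front s refl = bump-≡ (seen s) (deck (suc s) 0)

seen-suc-other : ∀ s {x} → deck (suc s) 0 ≢ x → seen (suc s) x ≡ seen s x
seen-suc-other s front≢x = bump-≢ (seen s) (front≢x ∘ sym)

seen-suc-behind : ∀ s {i x} → deck (suc s) i ≡ x → 1 ≤ i → seen (suc s) x ≡ seen s x
seen-suc-behind s at 1≤i = seen-suc-other s λ front≡x → front-unique (suc s) 1≤i (trans at (sym front≡x))

seen-monotone : ∀ x {s s′} → s ≤ s′ → seen s x ≤ seen s′ x
seen-monotone x s≤s′ = go (≤⇒≤′ s≤s′)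
  where
  go : ∀ {s s′} → s ≤′ s′ → seen s x ≤ seen s′ x
  go ≤′-refl = ≤-refl
  go {s′ = suc s′} (≤′-step s≤′s′) = ≤-trans (go s≤′s′) (c≤bump (seen s′) (deck (suc s′) 0) x)

seen-earlier : ∀ x {s s′} → seen s x < seen s′ x → s < s′
seen-earlier x {s} {s′} fewer with s <? s′
... | yes s<s′ = s<s′
... | no s≮s′  = ⊥-elim (<⇒≱ fewer (seen-monotone x (≮⇒≥ s≮s′)))

viewed-with-every-count : ∀ s x {m} → 1 ≤ m → m ≤ seen s x → Σ ℕ λ s′ → s′ ≤ s × Viewed x m s′
viewed-with-every-count zero zero          1≤m m≤0 = ⊥-elim (<⇒≱ 1≤m m≤0)
viewed-with-every-count zero (suc zero)    1≤m m≤1 = 0 , z≤n , refl , ≤-antisym 1≤m m≤1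
viewed-with-every-count zero (suc (suc x)) 1≤m m≤0 = ⊥-elim (<⇒≱ 1≤m m≤0)
viewed-with-every-count (suc s) x {m} 1≤m m≤ with deck (suc s) 0 ≟ x
... | no front≢x = map₂ (map₁ m≤n⇒m≤1+n)
  (viewed-with-every-count s x 1≤m (subst (m ≤_) (seen-suc-other s front≢x) m≤))
... | yes in-front with m≤n⇒m<n∨m≡n (subst (m ≤_) (seen-suc-front s in-front) m≤)
...   | inj₁ m≤seen = map₂ (map₁ m≤n⇒m≤1+n) (viewed-with-every-count s x 1≤m (≤-pred m≤seen))
...   | inj₂ m≡     = suc s , ≤-refl , in-front , trans (seen-suc-front s in-front) (sym m≡)

reinserted-after-view : ∀ s {x K} → Viewed x K s → deck (suc s) K ≡ x
reinserted-after-view s {x} (in-front , count) =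
  subst (λ p → deck (suc s) p ≡ x) (trans (cong (seen s) in-front) count) (card-reinserted s in-front)

seen-unchanged-while-behind : ∀ r s {j x} → deck s j ≡ x → r < j → seen (s + r) x ≡ seen s x
seen-unchanged-while-behind zero s _ _ = cong (λ u → seen u _) (+-identityʳ s)
seen-unchanged-while-behind (suc r) s {suc j} {x} at (s≤s r<j) = begin
  seen (s + suc r) x ≡⟨ cong (λ u → seen u x) (+-suc s r) ⟩
  seen (suc s + r) x ≡⟨ seen-unchanged-while-behind r (suc s) at′ r<j′ ⟩
  seen (suc s) x     ≡⟨ seen-suc-behind s at′ (≤-<-trans z≤n r<j′) ⟩
  seen s x           ∎
  where
  open ≡-Reasoning
  j′ : ℕ
  j′ = destination (frontCount s) (suc j)
  at′ : deck (suc s) j′ ≡ x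
  at′ = trans (deck-suc-destination s (suc j)) at
  r<j′ : r < j′
  r<j′ = <-≤-trans r<j (pred≤destination (frontCount s) j)

seen-stable-after-view : ∀ s {x K} r → Viewed x K s → r ≤ K → seen (s + r) x ≡ K
seen-stable-after-view s zero (_ , count) _ = trans (cong (λ u → seen u _) (+-identityʳ s)) count
seen-stable-after-view s {x} {K} (suc r) viewed r<K = begin
  seen (s + suc r) x ≡⟨ cong (λ u → seen u x) (+-suc s r) ⟩
  seen (suc s + r) x ≡⟨ seen-unchanged-while-behind r (suc s) back r<K ⟩
  seen (suc s) x     ≡⟨ seen-suc-behind s back (≤-<-trans z≤n r<K) ⟩
  seen s x           ≡⟨ proj₂ viewed ⟩
  K                  ∎
  where
  open ≡-Reasoning
  back : deck (suc s) K ≡ x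
  back = reinserted-after-view s viewed

ahead-reaches-front-first : ∀ r s {p q x y} → deck s p ≡ x → deck s q ≡ y → p < q →
                            deck (s + r) 0 ≡ y → Σ ℕ λ s′ → s′ ≤ s + r × deck s′ 0 ≡ x
ahead-reaches-front-first zero s _ at-q p<q y-in-front =
  ⊥-elim (front-unique s (≤-trans (s≤s z≤n) p<q)
    (trans at-q (sym (subst (λ u → deck u 0 ≡ _) (+-identityʳ s) y-in-front))))
ahead-reaches-front-first (suc r) s {zero} at-p _ _ _ = s , m≤m+n s (suc r) , at-p
ahead-reaches-front-first (suc r) s {suc p} {suc q} {y = y} at-p at-q (s≤s p<q) y-in-front =
  map₂ (map₁ λ s′≤ → ≤-trans s′≤ (≤-reflexive (sym (+-suc s r))))
    (ahead-reaches-front-first r (suc s)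
      (trans (deck-suc-destination s (suc p)) at-p) (trans (deck-suc-destination s (suc q)) at-q)
      (destination-monotone (frontCount s) p<q) (subst (λ u → deck u 0 ≡ y) (+-suc s r) y-in-front))

sumBelow : (ℕ → ℕ) → ℕ → ℕ
sumBelow f zero    = 0
sumBelow f (suc n) = f n + sumBelow f n

sumBelow-suc : ∀ f n → sumBelow f (suc n) ≡ f 0 + sumBelow (f ∘ suc) n
sumBelow-suc f zero    = refl
sumBelow-suc f (suc n) = begin
  f (suc n) + sumBelow f (suc n)               ≡⟨ cong (f (suc n) +_) (sumBelow-suc f n) ⟩
  f (suc n) + (f 0 + sumBelow (f ∘ suc) n)     ≡⟨ +-comm (f (suc n)) _ ⟩
  (f 0 + sumBelow (f ∘ suc) n) + f (suc n)     ≡⟨ +-assoc (f 0) _ _ ⟩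
  f 0 + (sumBelow (f ∘ suc) n + f (suc n))     ≡⟨ cong (f 0 +_) (+-comm _ (f (suc n))) ⟩
  f 0 + sumBelow (f ∘ suc) (suc n)             ∎
  where open ≡-Reasoning

sumBelow-mono : ∀ {f g} n → (∀ j → j < n → f j ≤ g j) → sumBelow f n ≤ sumBelow g n
sumBelow-mono zero    _    = z≤n
sumBelow-mono (suc n) f≤g = +-mono-≤ (f≤g n ≤-refl) (sumBelow-mono n λ j j<n → f≤g j (m≤n⇒m≤1+n j<n))

sumBelow-strict : ∀ {f g} n → (∀ j → j < suc n → f j ≤ g j) → f 0 < g 0 →
                  sumBelow f (suc n) < sumBelow g (suc n)
sumBelow-strict {f} {g} n f≤g f0<g0 = subst₂ _<_ (sym (sumBelow-suc f n)) (sym (sumBelow-suc g n))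
  (+-mono-<-≤ f0<g0 (sumBelow-mono n λ j j<n → f≤g (suc j) (s≤s j<n)))

sumBelow-cong : ∀ {f g} n → (∀ j → j < n → f j ≡ g j) → sumBelow f n ≡ sumBelow g n
sumBelow-cong zero    _    = refl
sumBelow-cong (suc n) f≡g = cong₂ _+_ (f≡g n ≤-refl) (sumBelow-cong n λ j j<n → f≡g j (m≤n⇒m≤1+n j<n))

sumBelow-origin : ∀ f {k n} → k < n → sumBelow (f ∘ origin k) n ≡ sumBelow f n
sumBelow-origin f {k} {suc n} (s≤s k≤n) with m≤n⇒m<n∨m≡n k≤n
... | inj₁ k<n = cong₂ _+_ (cong f (reinsert-> id k<n)) (sumBelow-origin f k<n)
... | inj₂ refl = begin
  f (origin k k) + sumBelow (f ∘ origin k) k ≡⟨ cong₂ _+_ (cong f (reinsert-≡ id k))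
                                                 (sumBelow-cong k λ j j<k → cong f (reinsert-< id j<k)) ⟩
  f 0 + sumBelow (f ∘ suc) k                 ≡⟨ sym (sumBelow-suc f k) ⟩
  sumBelow f (suc k)                         ∎
  where open ≡-Reasoning

-- While card 1 waits at position i with count K, all counts are at most K and
-- every step advances card 1 or raises the count of a card ahead of it.
backlog : ℕ → ℕ → ℕ → ℕ
backlog s K i = sumBelow (λ j → suc K ∸ seen s (deck s j)) i

backlog-advance : ∀ s {K a} → seen s 1 ≡ K → a < frontCount s →
                  backlog (suc s) K a < backlog s K (suc a)
backlog-advance s {K} {a} count a<c₀ = begin-strict
  backlog (suc s) K a                      ≤⟨ sumBelow-mono a later ⟩
  sumBelow (f ∘ suc) a                     <⟨ m<n+m _ (m<n⇒0<n∸m c₀<K+1) ⟩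
  (suc K ∸ frontCount s) + sumBelow (f ∘ suc) a ≡⟨ sumBelow-suc f a ⟨
  backlog s K (suc a)                      ∎
  where
  open ≤-Reasoning
  f : ℕ → ℕ
  f j = suc K ∸ seen s (deck s j)
  c₀<K+1 : frontCount s < suc K
  c₀<K+1 = s≤s (subst (frontCount s ≤_) count (seen≤seen-card1 s (card-positive s 0)))
  later : ∀ j → j < a → suc K ∸ seen (suc s) (deck (suc s) j) ≤ suc K ∸ seen s (deck s (suc j))
  later j j<a = ∸-monoʳ-≤ (suc K) (subst (λ x → seen s x ≤ seen (suc s) (deck (suc s) j))
    (reinsert-< (deck s) (<-trans j<a a<c₀)) (c≤bump (seen s) _ _))

backlog-stall : ∀ s {K a} → seen s 1 ≡ K → frontCount s ≤ a →
                backlog (suc s) K (suc a) < backlog s K (suc a)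
backlog-stall s {K} {a} count c₀≤a = begin-strict
  backlog (suc s) K (suc a)
    <⟨ sumBelow-strict a (λ j _ → ∸-monoʳ-≤ (suc K) (c≤bump (seen s) _ _)) front-bumped ⟩
  sumBelow (λ j → suc K ∸ seen s (deck (suc s) j)) (suc a)
    ≡⟨ sumBelow-cong (suc a) (λ j _ → cong (λ x → suc K ∸ seen s x) (reinsert-origin (deck s) (frontCount s) j)) ⟩
  sumBelow (f ∘ origin (frontCount s)) (suc a)
    ≡⟨ sumBelow-origin f (s≤s c₀≤a) ⟩
  backlog s K (suc a) ∎
  where
  open ≤-Reasoning
  f : ℕ → ℕ
  f j = suc K ∸ seen s (deck s j)
  y : ℕ
  y = deck (suc s) 0
  front-bumped : suc K ∸ seen (suc s) y < suc K ∸ seen s y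
  front-bumped = ∸-monoʳ-< (subst (seen s y <_) (sym (seen-suc-front s refl)) ≤-refl)
    (subst (_≤ suc K) (sym (seen-suc-front s refl))
      (s≤s (subst (seen s y ≤_) count (seen≤seen-card1 s (card-positive (suc s) 0)))))

Card1Waiting : ℕ → ℕ → ℕ → Set
Card1Waiting K s i = 1 ≤ i × deck s i ≡ 1 × seen s 1 ≡ K

card1-step : ∀ s {K i} → Card1Waiting K s i →
             Viewed 1 (suc K) (suc s) ⊎
             Σ ℕ λ i′ → Card1Waiting K (suc s) i′ × backlog (suc s) K i′ < backlog s K i
card1-step s {i = suc zero} (_ , at , count) =
  inj₁ (arrived , trans (seen-suc-front s arrived) (cong suc count))
  where
  arrived : deck (suc s) 0 ≡ 1
  arrived = card-advances s at (Invariant.front-seen (invariant s))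
card1-step s {i = suc (suc a)} (_ , at , count) with suc a <? frontCount s
... | yes a<c₀ = inj₂ (suc a , (s≤s z≤n , moved , trans (seen-suc-behind s moved (s≤s z≤n)) count) ,
                      backlog-advance s count a<c₀)
  where
  moved : deck (suc s) (suc a) ≡ 1
  moved = card-advances s at a<c₀
... | no a≮c₀ = inj₂ (suc (suc a) , (s≤s z≤n , stays , trans (seen-suc-behind s stays (s≤s z≤n)) count) ,
                     backlog-stall s count (≮⇒≥ a≮c₀))
  where
  stays : deck (suc s) (suc (suc a)) ≡ 1
  stays = card-stays s at (≮⇒≥ a≮c₀)

card1-viewed-again : ∀ fuel s {K i} → backlog s K i < fuel → Card1Waiting K s i → Σ ℕ (Viewed 1 (suc K))
card1-viewed-again (suc fuel) s backlog<fuel waiting with card1-step s waiting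
... | inj₁ viewed = suc s , viewed
... | inj₂ (i′ , waiting′ , shrinks) =
  card1-viewed-again fuel (suc s) (<-≤-trans shrinks (≤-pred backlog<fuel)) waiting′

card1-viewed : ∀ K → 1 ≤ K → Σ ℕ (Viewed 1 K)
card1-viewed (suc zero)    _ = 0 , refl , refl
card1-viewed (suc (suc K)) _ with card1-viewed (suc K) (s≤s z≤n)
... | s , viewed = card1-viewed-again _ (suc s) ≤-refl
  (s≤s z≤n , back , trans (seen-suc-behind s back (s≤s z≤n)) (proj₂ viewed))
  where
  back : deck (suc s) (suc K) ≡ 1
  back = reinserted-after-view s viewed

only-next-card-stalls : ∀ s k → seen s 1 ≤ k → frontCount s < seen s k → deck s 0 ≡ suc k
only-next-card-stalls s k card1≤k stall = classify (deck s 0) refl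
  where
  open Invariant (invariant s)
  classify : ∀ y → deck s 0 ≡ y → y ≡ suc k
  classify zero    in-front = ⊥-elim (n≮0 (subst (0 <_) in-front (positive 0)))
  classify (suc x) in-front with <-cmp x k
  ... | tri< x<k _ _  = ⊥-elim (<⇒≱ stall
    (subst (λ y → seen s k ≤ seen s y) (sym in-front) (antitone (suc x) k (s≤s z≤n) x<k)))
  ... | tri≈ _ refl _ = refl
  ... | tri> _ _ k<x  = ⊥-elim (n≮0 (subst (k <_)
    (injective x 0 (trans (untouched x (≤-<-trans card1≤k k<x)) (sym in-front))) k<x))

triangle : ℕ → ℕ
triangle zero    = 0
triangle (suc n) = suc n + triangle n

triangle-monotone : ∀ {m n} → m ≤ n → triangle m ≤ triangle n
triangle-monotone m≤n = go (≤⇒≤′ m≤n)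
  where
  go : ∀ {m n} → m ≤′ n → triangle m ≤ triangle n
  go ≤′-refl          = ≤-refl
  go (≤′-step m≤′n) = ≤-trans (go m≤′n) (m≤n+m _ _)

module CardProgress (k ℓ : ℕ) where

  remaining : ℕ → ℕ
  remaining m = triangle ℓ ∸ triangle m

  remaining-suc : ∀ m → m < ℓ → remaining m ≡ suc m + remaining (suc m)
  remaining-suc m m<ℓ = begin
    triangle ℓ ∸ triangle m
      ≡⟨ sym (m+[n∸m]≡n room) ⟩
    suc m + ((triangle ℓ ∸ triangle m) ∸ suc m)
      ≡⟨ cong (suc m +_) (∸-+-assoc (triangle ℓ) (triangle m) (suc m)) ⟩
    suc m + (triangle ℓ ∸ (triangle m + suc m))
      ≡⟨ cong (λ t → suc m + (triangle ℓ ∸ t)) (+-comm (triangle m) (suc m)) ⟩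
    suc m + remaining (suc m) ∎
    where
    open ≡-Reasoning
    room : suc m ≤ triangle ℓ ∸ triangle m
    room = m+n≤o⇒m≤o∸n (suc m) (triangle-monotone m<ℓ)

  -- Unless it is stalled, a card at position i seen m times reaches count ℓ
  -- after workLeft i m steps.
  workLeft : ℕ → ℕ → ℕ
  workLeft zero    m = remaining m
  workLeft (suc i) m = suc i + remaining (suc m)

  workLeft-positive : ∀ i {m} → m < ℓ → 1 ≤ workLeft i m
  workLeft-positive zero    {m} m<ℓ = subst (1 ≤_) (sym (remaining-suc m m<ℓ)) (s≤s z≤n)
  workLeft-positive (suc i) _     = s≤s z≤n

  workLeft-from-front : ∀ m → 1 ≤ m → m < ℓ → workLeft m m < workLeft 0 m
  workLeft-from-front (suc j) _ m<ℓ =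
    subst (suc j + remaining (suc (suc j)) <_) (sym (remaining-suc (suc j) m<ℓ)) ≤-refl

  frontIsNext : ℕ → ℕ
  frontIsNext s = if deck s 0 ≡ᵇ suc k then 1 else 0

  frontIsNext-yes : ∀ s → deck s 0 ≡ suc k → frontIsNext s ≡ 1
  frontIsNext-yes s next rewrite dec-true (deck s 0 ≟ suc k) next = refl

  frontIsNext-no : ∀ s → deck s 0 ≢ suc k → frontIsNext s ≡ 0
  frontIsNext-no s ¬next rewrite dec-false (deck s 0 ≟ suc k) ¬next = refl

  frontIsNext≤1 : ∀ s → frontIsNext s ≤ 1
  frontIsNext≤1 s with deck s 0 ≡ᵇ suc k
  ... | true  = ≤-refl
  ... | false = z≤n

  -- A stall spends a view of card k + 1 made while its count is below ℓ
  -- (the current view included).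
  stallBudget : ℕ → ℕ
  stallBudget s = (ℓ + frontIsNext s) ∸ seen s (suc k)

  stallBudget-suc : ∀ s → stallBudget (suc s) ≡ ℓ ∸ seen s (suc k)
  stallBudget-suc s with deck (suc s) 0 ≟ suc k
  ... | yes next = begin
    (ℓ + frontIsNext (suc s)) ∸ seen (suc s) (suc k)
      ≡⟨ cong₂ (λ b c → (ℓ + b) ∸ c) (frontIsNext-yes (suc s) next) (seen-suc-front s next) ⟩
    (ℓ + 1) ∸ suc (seen s (suc k))
      ≡⟨ cong (_∸ suc (seen s (suc k))) (+-comm ℓ 1) ⟩
    ℓ ∸ seen s (suc k) ∎
    where open ≡-Reasoning
  ... | no ¬next = begin
    (ℓ + frontIsNext (suc s)) ∸ seen (suc s) (suc k)
      ≡⟨ cong₂ (λ b c → (ℓ + b) ∸ c) (frontIsNext-no (suc s) ¬next) (seen-suc-other s ¬next) ⟩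
    (ℓ + 0) ∸ seen s (suc k)
      ≡⟨ cong (_∸ seen s (suc k)) (+-identityʳ ℓ) ⟩
    ℓ ∸ seen s (suc k) ∎
    where open ≡-Reasoning

  stallBudget-nonincreasing : ∀ s → stallBudget (suc s) ≤ stallBudget s
  stallBudget-nonincreasing s = subst (_≤ stallBudget s) (sym (stallBudget-suc s))
    (∸-monoˡ-≤ (seen s (suc k)) (m≤m+n ℓ (frontIsNext s)))

  stallBudget-decreasing : ∀ s → deck s 0 ≡ suc k → seen s (suc k) ≤ ℓ →
                           stallBudget (suc s) < stallBudget s
  stallBudget-decreasing s next seen≤ℓ = begin-strict
    stallBudget (suc s)         ≡⟨ stallBudget-suc s ⟩
    ℓ ∸ seen s (suc k)          <⟨ m<m+n _ (s≤s z≤n) ⟩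
    (ℓ ∸ seen s (suc k)) + 1    ≡⟨ sym (+-∸-comm 1 seen≤ℓ) ⟩
    (ℓ + 1) ∸ seen s (suc k)    ≡⟨ cong (λ b → (ℓ + b) ∸ seen s (suc k)) (frontIsNext-yes s next) ⟨
    stallBudget s               ∎
    where open ≤-Reasoning

  potential : ℕ → ℕ → ℕ
  potential s i = workLeft i (seen s k) + stallBudget s

  potential-at-front : ∀ s → potential s 0 ≤ triangle ℓ + suc ℓ
  potential-at-front s = +-mono-≤ (m∸n≤m (triangle ℓ) (triangle (seen s k)))
    (≤-trans (m∸n≤m (ℓ + frontIsNext s) (seen s (suc k)))
      (subst (ℓ + frontIsNext s ≤_) (+-comm ℓ 1) (+-monoʳ-≤ ℓ (frontIsNext≤1 s))))

  decrease-from-front : ∀ s → deck s 0 ≡ k → seen s k < ℓ → potential (suc s) (frontCount s) < potential s 0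
  decrease-from-front s in-front m<ℓ = begin-strict
    workLeft (frontCount s) (seen (suc s) k) + stallBudget (suc s)
      ≡⟨ cong₂ (λ p m′ → workLeft p m′ + stallBudget (suc s)) c₀≡m count-kept ⟩
    workLeft m m + stallBudget (suc s)
      <⟨ +-mono-<-≤ (workLeft-from-front m (subst (1 ≤_) c₀≡m 1≤c₀) m<ℓ) (stallBudget-nonincreasing s) ⟩
    potential s 0 ∎
    where
    open ≤-Reasoning
    m : ℕ
    m = seen s k
    1≤c₀ : 1 ≤ frontCount s
    1≤c₀ = Invariant.front-seen (invariant s)
    c₀≡m : frontCount s ≡ m
    c₀≡m = cong (seen s) in-front
    count-kept : seen (suc s) k ≡ m
    count-kept = seen-suc-behind s (card-reinserted s in-front) 1≤c₀

  decrease-advancing : ∀ s {a} → deck s (suc a) ≡ k → a < frontCount s → potential (suc s) a < potential s (suc a)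
  decrease-advancing s {zero} at 0<c₀ = +-mono-<-≤
    (subst (λ m′ → remaining m′ < suc (remaining (suc (seen s k))))
      (sym (seen-suc-front s (card-advances s at 0<c₀))) ≤-refl)
    (stallBudget-nonincreasing s)
  decrease-advancing s {suc a} at a<c₀ = +-mono-<-≤
    (subst (λ m′ → suc a + remaining (suc m′) < suc (suc a) + remaining (suc (seen s k)))
      (sym (seen-suc-behind s (card-advances s at a<c₀) (s≤s z≤n))) ≤-refl)
    (stallBudget-nonincreasing s)

  decrease-stalled : ∀ s {a} → deck s (suc a) ≡ k → frontCount s ≤ a → 1 ≤ seen s k → seen s 1 ≤ k →
                     seen s k < ℓ → potential (suc s) (suc a) < potential s (suc a)
  decrease-stalled s {a} at c₀≤a 1≤m card1≤k m<ℓ = +-mono-≤-<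
    (≤-reflexive (cong (workLeft (suc a)) (seen-suc-behind s (card-stays s at c₀≤a) (s≤s z≤n))))
    (stallBudget-decreasing s next (<⇒≤ (<-trans next-count m<ℓ)))
    where
    m : ℕ
    m = seen s k
    count≡m : seen s (deck s (suc a)) ≡ m
    count≡m = cong (seen s) at
    c₀<m : frontCount s < m
    c₀<m = <-≤-trans (s≤s c₀≤a) (subst (suc a ≤_) count≡m
      (Invariant.position≤seen (invariant s) (suc a) (s≤s z≤n) (subst (1 ≤_) (sym count≡m) 1≤m)))
    next : deck s 0 ≡ suc k
    next = only-next-card-stalls s k card1≤k c₀<m
    next-count : seen s (suc k) < m
    next-count = subst (_< m) (cong (seen s) next) c₀<m

  potential-decreases : ∀ s {i} → deck s i ≡ k → 1 ≤ seen s k → seen s 1 ≤ k → seen s k < ℓ →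
                        Σ ℕ λ i′ → deck (suc s) i′ ≡ k × potential (suc s) i′ < potential s i
  potential-decreases s {zero} at _ _ m<ℓ = frontCount s , card-reinserted s at , decrease-from-front s at m<ℓ
  potential-decreases s {suc a} at 1≤m card1≤k m<ℓ with a <? frontCount s
  ... | yes a<c₀ = a , card-advances s at a<c₀ , decrease-advancing s at a<c₀
  ... | no a≮c₀  =
    suc a , card-stays s at (≮⇒≥ a≮c₀) , decrease-stalled s at (≮⇒≥ a≮c₀) 1≤m card1≤k m<ℓ

  reaches-count : ∀ r s {i} → deck s i ≡ k → 1 ≤ seen s k → seen (s + r) 1 ≤ k → potential s i ≤ r →
                  Σ ℕ λ s* → s* ≤ s + r × ℓ ≤ seen s* k
  reaches-count r s at 1≤m card1≤k bounded with ℓ ≤? seen s k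
  ... | yes done = s , m≤m+n s r , done
  reaches-count zero s {i} at 1≤m card1≤k bounded | no ℓ≰m =
    ⊥-elim (n≮0 (≤-trans (workLeft-positive i (≰⇒> ℓ≰m)) (≤-trans (m≤m+n _ _) bounded)))
  reaches-count (suc r) s at 1≤m card1≤k bounded | no ℓ≰m
    with potential-decreases s at 1≤m (≤-trans (seen-monotone 1 (m≤m+n s (suc r))) card1≤k) (≰⇒> ℓ≰m)
  ... | i′ , at′ , smaller = map₂ (map₁ λ s*≤ → ≤-trans s*≤ (≤-reflexive (sym (+-suc s r))))
    (reaches-count r (suc s) at′ (≤-trans 1≤m (seen-monotone k (n≤1+n s)))
      (subst (λ u → seen u 1 ≤ k) (+-suc s r) card1≤k) (≤-pred (<-≤-trans smaller bounded)))

  reaches-count-by : ∀ s T → deck s 0 ≡ k → seen T 1 ≤ k → s + (triangle ℓ + suc ℓ) ≤ T →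
                     Σ ℕ λ s* → s* ≤ T × ℓ ≤ seen s* k
  reaches-count-by s T in-front card1≤k long-enough =
    map₂ (map₁ λ s*≤ → ≤-trans s*≤ (≤-reflexive s+r≡T))
      (reaches-count (T ∸ s) s in-front 1≤m (subst (λ u → seen u 1 ≤ k) (sym s+r≡T) card1≤k)
        (≤-trans (potential-at-front s) (m+n≤o⇒m≤o∸n _ (subst (_≤ T) (+-comm s _) long-enough))))
    where
    s+r≡T : s + (T ∸ s) ≡ T
    s+r≡T = m+[n∸m]≡n (≤-trans (m≤m+n s _) long-enough)
    1≤m : 1 ≤ seen s k
    1≤m = subst (λ x → 1 ≤ seen s x) in-front (Invariant.front-seen (invariant s))

card-in-front-before-card1 : ∀ {k} s₂ → 2 ≤ k → Viewed 1 k s₂ → Σ ℕ λ s → s ≤ s₂ × deck s 0 ≡ k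
card-in-front-before-card1 {suc K} s₂ (s≤s 1≤K) viewed₂ with card1-viewed K 1≤K
... | s₁ , viewed₁ with Invariant.surjective (invariant s₁) (suc K) (s≤s z≤n)
...   | zero , at = ⊥-elim (n≮0 (subst (0 <_) (suc-injective (trans (sym at) (proj₁ viewed₁))) 1≤K))
...   | suc a , at =
  map₂ (map₁ λ s≤ → ≤-trans s≤ (≤-reflexive (m+[n∸m]≡n s₁<s₂)))
    (ahead-reaches-front-first (s₂ ∸ suc s₁) (suc s₁)
      (card-advances s₁ at (subst (a <_) (sym c₀≡K) a<K)) (reinserted-after-view s₁ viewed₁) a<K
      (subst (λ u → deck u 0 ≡ 1) (sym (m+[n∸m]≡n s₁<s₂)) (proj₁ viewed₂)))
  where
  c₀≡K : frontCount s₁ ≡ K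
  c₀≡K = trans (cong (seen s₁) (proj₁ viewed₁)) (proj₂ viewed₁)
  s₁<s₂ : s₁ < s₂
  s₁<s₂ = seen-earlier 1 (subst₂ _<_ (sym (proj₂ viewed₁)) (sym (proj₂ viewed₂)) ≤-refl)
  a<K : a < K
  a<K with a <? K
  ... | yes a<K = a<K
  ... | no a≮K  = ⊥-elim (≤⇒≯ K≤a (≤-reflexive (suc-injective (trans
    (sym (Invariant.untouched (invariant s₁) (suc a) (subst (_< suc a) (sym (proj₂ viewed₁)) (s≤s K≤a))))
    at))))
    where
    K≤a : K ≤ a
    K≤a = ≮⇒≥ a≮K

card-viewed-before-card1 : ∀ k ℓ → 1 ≤ ℓ → triangle ℓ + suc ℓ ≤ k →
                           Σ ℕ λ s₁ → Σ ℕ λ s₂ → Viewed k ℓ s₁ × Viewed 1 (suc k) s₂ × s₁ < s₂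
card-viewed-before-card1 k ℓ 1≤ℓ fits =
  let (s₂ , viewed₂) = card1-viewed k (≤-trans (s≤s z≤n) 2≤k)
      (s₃ , viewed₃) = card1-viewed (suc k) (s≤s z≤n)
      (s , s≤s₂ , in-front) = card-in-front-before-card1 s₂ 2≤k viewed₂
      card1-stays = seen-stable-after-view s₂ k viewed₂ ≤-refl
      (s* , s*≤ , ℓ≤count) =
        CardProgress.reaches-count-by k ℓ s (s₂ + k) in-front (≤-reflexive card1-stays) (+-mono-≤ s≤s₂ fits)
      (s₁ , s₁≤s* , viewed₁) = viewed-with-every-count s* k 1≤ℓ ℓ≤count
  in s₁ , s₃ , viewed₁ , viewed₃ ,
     ≤-<-trans (≤-trans s₁≤s* s*≤)
       (seen-earlier 1 (subst₂ _<_ (sym card1-stays) (sym (proj₂ viewed₃)) ≤-refl))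
  where
  2≤k : 2 ≤ k
  2≤k = ≤-trans (s≤s 1≤ℓ) (≤-trans (m≤n+m (suc ℓ) (triangle ℓ)) fits)

double-triangle : ∀ n → 2 * triangle n ≡ n * suc n
double-triangle zero    = refl
double-triangle (suc n) = begin
  2 * (suc n + triangle n)     ≡⟨ *-distribˡ-+ 2 (suc n) (triangle n) ⟩
  2 * suc n + 2 * triangle n   ≡⟨ cong (2 * suc n +_) (double-triangle n) ⟩
  2 * suc n + n * suc n        ≡⟨ regroup n ⟩
  suc n * suc (suc n)          ∎
  where
  open ≡-Reasoning
  regroup : ∀ n → 2 * suc n + n * suc n ≡ suc n * suc (suc n)
  regroup = solve-∀

triangle-fits : ∀ ℓ k → (ℓ + 2) * (ℓ + 2) ≤ 2 * k → triangle ℓ + suc ℓ ≤ k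
triangle-fits ℓ k square≤ = *-cancelˡ-≤ 2 (≤-trans (m≤m+n _ (ℓ + 2)) (≤-trans (≤-reflexive square) square≤))
  where
  open ≡-Reasoning
  expand : ∀ ℓ t → 2 * (t + suc ℓ) + (ℓ + 2) ≡ 2 * t + (3 * ℓ + 4)
  expand = solve-∀
  complete : ∀ ℓ → ℓ * suc ℓ + (3 * ℓ + 4) ≡ (ℓ + 2) * (ℓ + 2)
  complete = solve-∀
  square : 2 * (triangle ℓ + suc ℓ) + (ℓ + 2) ≡ (ℓ + 2) * (ℓ + 2)
  square = begin
    2 * (triangle ℓ + suc ℓ) + (ℓ + 2)  ≡⟨ expand ℓ (triangle ℓ) ⟩
    2 * triangle ℓ + (3 * ℓ + 4)        ≡⟨ cong (_+ (3 * ℓ + 4)) (double-triangle ℓ) ⟩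
    ℓ * suc ℓ + (3 * ℓ + 4)             ≡⟨ complete ℓ ⟩
    (ℓ + 2) * (ℓ + 2)                   ∎

square-bound : ∀ ℓ k → (ℤ.+ ℓ ℤ.- ℤ.-[1+ 1 ]) ℤ.≤ ℤ.+ 0 ⊎
               (ℤ.+ ℓ ℤ.- ℤ.-[1+ 1 ]) ℤ.* (ℤ.+ ℓ ℤ.- ℤ.-[1+ 1 ]) ℤ.≤ ℤ.+ (2 * k) →
               (ℓ + 2) * (ℓ + 2) ≤ 2 * k
square-bound ℓ k (inj₁ ℓ+2≤0) = ⊥-elim (n≮0 (≤-trans (m≤n+m 2 ℓ) (ℤ.drop‿+≤+ ℓ+2≤0)))
square-bound ℓ k (inj₂ square≤) =
  ℤ.drop‿+≤+ (subst (ℤ._≤ ℤ.+ (2 * k)) (sym (ℤ.pos-* (ℓ + 2) (ℓ + 2))) square≤)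

viewed⇒SeenAt : ∀ {x m s} → Viewed x m s → SeenAt x m (suc s)
viewed⇒SeenAt (in-front , count) = s≤s z≤n , in-front , count

-- With C = −2 the hypothesis reads (ℓ + 2)² ≤ 2k.
mainTheorem6 : Σ ℤ.ℤ λ C → (k : ℕ) → 1 ≤ k → (ℓ : ℕ) → 1 ≤ ℓ →
    ((ℤ.+ ℓ ℤ.- C) ℤ.≤ ℤ.+ 0 ⊎ (ℤ.+ ℓ ℤ.- C) ℤ.* (ℤ.+ ℓ ℤ.- C) ℤ.≤ ℤ.+ (2 * k)) →
    Σ ℕ λ t₁ → Σ ℕ λ t₂ → SeenAt k ℓ t₁ × SeenAt 1 (suc k) t₂ × t₁ < t₂
mainTheorem6 = ℤ.-[1+ 1 ] , λ k _ ℓ 1≤ℓ bound →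
  let (s₁ , s₂ , viewed₁ , viewed₂ , s₁<s₂) =
        card-viewed-before-card1 k ℓ 1≤ℓ (triangle-fits ℓ k (square-bound ℓ k bound))
  in suc s₁ , suc s₂ , viewed⇒SeenAt viewed₁ , viewed⇒SeenAt viewed₂ , s≤s s₁<s₂
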